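{- Let $\mathcal G=\langle G,h,g\rangle$ be a losing hat guessing game on a finite directed graph $G$, and let $u,v\in V(G)$ be such that $\vec{uv}\notin E(G)$. Let $G'$ be obtained from $G$ by adding the directed edge $\vec{uv}$. Define $g'(x)=g(x)$ for $x\ne u$ and $g'(u)=\lfloor g(u)/h(v)\rfloor$. Then the game $\langle G',h,g'\rangle$ is losing.
   Context: Hat guessing game $\langle G,h,g\rangle$ on a directed graph $G$ with $h,g\colon V(G)\to\mathbb N$. A directed edge $\vec{uv}$ means $u$ sees $v$. The adversary gives each vertex $v$ a color in $\{0,\dots,h(v)-1\}$. Each vertex $x$ sees only the colors of its out-neighbors and names at most $g(x)$ colors via a deterministic strategy fixed in advance that depends only on those colors. The game is winning if some strategy ensures that for every assignment some vertex names its own color; otherwise it is losing. -}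

module Defs where

open import Data.Nat using (ℕ; _≤_; _/_; NonZero)
open import Data.Fin using (Fin; _≟_)
open import Data.Bool using (Bool; true; false; _∨_; _∧_)
open import Data.List using (List; length)
open import Data.List.Membership.Propositional using (_∈_)
open import Data.Product using (Σ; ∃; _×_)
open import Relation.Binary.PropositionalEquality using (_≡_; _≢_)
open import Relation.Nullary using (¬_)
open import Relation.Nullary.Decidable using (⌊_⌋)

-- A finite directed graph on vertex set Fin n, given by its edge relation:
-- E x y ≡ true means there is a directed edge x → y, i.e. x sees y.
Digraph : ℕ → Set
Digraph n = Fin n → Fin n → Bool

Loopless : ∀ {n} → Digraph n → Set
Loopless {n} E = (x : Fin n) → E x x ≡ false

Coloring : ∀ {n} → (Fin n → ℕ) → Set
Coloring {n} h = (w : Fin n) → Fin (h w)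

AgreeOnOut : ∀ {n} → Digraph n → (h : Fin n → ℕ) → Fin n → Coloring h → Coloring h → Set
AgreeOnOut {n} E h x c d = (w : Fin n) → E x w ≡ true → c w ≡ d w

record Strategy {n} (E : Digraph n) (h g : Fin n → ℕ) : Set where
  field
    guess    : (x : Fin n) → Coloring h → List (Fin (h x))
    local    : (x : Fin n) (c d : Coloring h) → AgreeOnOut E h x c d → guess x c ≡ guess x d
    bounded  : (x : Fin n) (c : Coloring h) → length (guess x c) ≤ g x

Winning : ∀ {n} → Digraph n → (h g : Fin n → ℕ) → Set
Winning {n} E h g = Σ (Strategy E h g) λ S →
  (c : Coloring h) → ∃ λ (x : Fin n) → c x ∈ Strategy.guess S x c

Losing : ∀ {n} → Digraph n → (h g : Fin n → ℕ) → Set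
Losing E h g = ¬ Winning E h g

addEdge : ∀ {n} → Digraph n → Fin n → Fin n → Digraph n
addEdge E u v x y = E x y ∨ (⌊ x ≟ u ⌋ ∧ ⌊ y ≟ v ⌋)

modifyGuesses : ∀ {n} → (h g : Fin n → ℕ) → (u v : Fin n) → .{{NonZero (h v)}} → Fin n → ℕ
modifyGuesses h g u v x with x ≟ u
... | Relation.Nullary.yes _ = g u / h v
... | Relation.Nullary.no _  = g x

-- From a winning strategy on G' one obtains one on G: u no longer sees v, so it
-- guesses, for every possible colour a of v, what it would have guessed in G' had v
-- worn a. One of these h(v) hypotheses is the true one, so u still guesses correctly
-- whenever it did in G', at the price of h(v) · ⌊g(u)/h(v)⌋ ≤ g(u) guesses.
module Submission where

open import Defs
open import Data.Nat using (ℕ; NonZero; _+_; _*_; _≤_; _/_; z≤n)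
open import Data.Nat.Properties using (≤-reflexive; ≤-trans; +-mono-≤; *-comm; module ≤-Reasoning)
open import Data.Nat.DivMod using (m/n*n≤m)
open import Data.Fin using (Fin; _≟_)
open import Data.Bool using (true; false)
open import Data.List using (List; []; _∷_; _++_; length; concatMap; allFin)
open import Data.List.Properties using (length-++; length-tabulate; concatMap-cong)
open import Data.List.Membership.Propositional using (_∈_; lose)
open import Data.List.Membership.Propositional.Properties using (∈-concatMap⁺; ∈-allFin)
open import Data.Product using (_×_; _,_)
open import Data.Sum using (_⊎_; inj₁; inj₂)
open import Data.Empty using (⊥-elim)
open import Function using (id)
open import Relation.Nullary using (yes; no)
open import Relation.Binary.PropositionalEquality using (_≡_; _≢_; refl; sym; trans; cong; subst)

length-concatMap-≤ : ∀ {A B : Set} (f : A → List B) {b : ℕ} (xs : List A) →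
                     (∀ x → length (f x) ≤ b) → length (concatMap f xs) ≤ length xs * b
length-concatMap-≤ f []       bound = z≤n
length-concatMap-≤ f {b} (x ∷ xs) bound = begin
  length (f x ++ concatMap f xs)         ≡⟨ length-++ (f x) ⟩
  length (f x) + length (concatMap f xs) ≤⟨ +-mono-≤ (bound x) (length-concatMap-≤ f xs bound) ⟩
  b + length xs * b                      ∎
  where open ≤-Reasoning

∈-concatMap-allFin : ∀ {k} {B : Set} (f : Fin k → List B) (a : Fin k) {y : B} →
                     y ∈ f a → y ∈ concatMap f (allFin k)
∈-concatMap-allFin f a y∈fa = ∈-concatMap⁺ f (lose (∈-allFin a) y∈fa)

module _ {n : ℕ} (E : Digraph n) (u v : Fin n) where

  addEdge-true⁻ : ∀ {x w} → addEdge E u v x w ≡ true → E x w ≡ true ⊎ (x ≡ u × w ≡ v)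
  addEdge-true⁻ {x} {w} e with E x w | x ≟ u | w ≟ v
  ... | true  | _       | _       = inj₁ refl
  ... | false | yes x≡u | yes w≡v = inj₂ (x≡u , w≡v)
  addEdge-true⁻ () | false | yes _ | no _
  addEdge-true⁻ () | false | no _  | _

  AgreeOnOut-addEdge : ∀ (h : Fin n → ℕ) {x} {c d : Coloring h} →
                       AgreeOnOut E h x c d → (x ≡ u → c v ≡ d v) →
                       AgreeOnOut (addEdge E u v) h x c d
  AgreeOnOut-addEdge h agree agree-v w e with addEdge-true⁻ e
  ... | inj₁ e-old        = agree w e-old
  ... | inj₂ (x≡u , refl) = agree-v x≡u

module _ {n : ℕ} (h g : Fin n → ℕ) (u v : Fin n) .{{_ : NonZero (h v)}} where

  modifyGuesses-≡ : modifyGuesses h g u v u ≡ g u / h v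
  modifyGuesses-≡ with u ≟ u
  ... | yes _  = refl
  ... | no u≢u = ⊥-elim (u≢u refl)

  modifyGuesses-≢ : ∀ {x} → x ≢ u → modifyGuesses h g u v x ≡ g x
  modifyGuesses-≢ {x} x≢u with x ≟ u
  ... | yes x≡u = ⊥-elim (x≢u x≡u)
  ... | no _    = refl

module _ {n : ℕ} {h : Fin n → ℕ} where

  _[_≔_] : Coloring h → (v : Fin n) → Fin (h v) → Coloring h
  (c [ v ≔ a ]) w with w ≟ v
  ... | yes refl = a
  ... | no _     = c w

  [≔]-self : ∀ (c : Coloring h) v w → (c [ v ≔ c v ]) w ≡ c w
  [≔]-self c v w with w ≟ v
  ... | yes refl = refl
  ... | no _     = refl

  [≔]-cong : ∀ {c d : Coloring h} v a w → c w ≡ d w → (c [ v ≔ a ]) w ≡ (d [ v ≔ a ]) w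
  [≔]-cong v a w cw≡dw with w ≟ v
  ... | yes refl = refl
  ... | no _     = cw≡dw

  [≔]-at : ∀ (c : Coloring h) v a → (c [ v ≔ a ]) v ≡ a
  [≔]-at c v a with v ≟ v
  ... | yes refl = refl
  ... | no v≢v   = ⊥-elim (v≢v refl)

module RemoveEdge {n : ℕ} (E : Digraph n) (h : Fin n → ℕ) (u v : Fin n) {g' : Fin n → ℕ}
                  (S' : Strategy (addEdge E u v) h g') where
  open Strategy S'

  guessBlind : (x : Fin n) → Coloring h → List (Fin (h x))
  guessBlind x c with x ≟ u
  ... | yes refl = concatMap (λ a → guess u (c [ v ≔ a ])) (allFin (h v))
  ... | no _     = guess x c

  guessBlind-local : ∀ x (c d : Coloring h) → AgreeOnOut E h x c d → guessBlind x c ≡ guessBlind x d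
  guessBlind-local x c d agree with x ≟ u
  ... | yes refl = concatMap-cong (λ a → local u _ _ (updated-agree a)) (allFin (h v))
    where
    updated-agree : ∀ a → AgreeOnOut (addEdge E u v) h u (c [ v ≔ a ]) (d [ v ≔ a ])
    updated-agree a = AgreeOnOut-addEdge E u v h (λ w e → [≔]-cong {c = c} {d = d} v a w (agree w e))
                        (λ _ → trans ([≔]-at c v a) (sym ([≔]-at d v a)))
  ... | no x≢u   = local x c d (AgreeOnOut-addEdge E u v h agree (λ x≡u → ⊥-elim (x≢u x≡u)))

  guessBlind-bounded : ∀ {g : Fin n → ℕ} → (∀ x → x ≢ u → g' x ≤ g x) → h v * g' u ≤ g u →
                       ∀ x (c : Coloring h) → length (guessBlind x c) ≤ g x
  guessBlind-bounded {g} off-u at-u x c with x ≟ u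
  ... | yes refl = begin
    length (concatMap (λ a → guess u (c [ v ≔ a ])) (allFin (h v)))
      ≤⟨ length-concatMap-≤ _ (allFin (h v)) (λ a → bounded u (c [ v ≔ a ])) ⟩
    length (allFin (h v)) * g' u ≡⟨ cong (_* g' u) (length-tabulate {n = h v} id) ⟩
    h v * g' u                   ≤⟨ at-u ⟩
    g u                          ∎
    where open ≤-Reasoning
  ... | no x≢u = ≤-trans (bounded x c) (off-u x x≢u)

  guessBlind-correct : ∀ (c : Coloring h) x → c x ∈ guess x c → c x ∈ guessBlind x c
  guessBlind-correct c x correct with x ≟ u
  ... | yes refl = ∈-concatMap-allFin (λ a → guess u (c [ v ≔ a ])) (c v)
                     (subst (c u ∈_) (local u c _ (λ w _ → sym ([≔]-self c v w))) correct)
  ... | no _     = correct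

Winning-removeEdge : ∀ {n} (E : Digraph n) (h : Fin n → ℕ) (u v : Fin n) {g' g : Fin n → ℕ} →
                     (∀ x → x ≢ u → g' x ≤ g x) → h v * g' u ≤ g u →
                     Winning (addEdge E u v) h g' → Winning E h g
Winning-removeEdge E h u v off-u at-u (S' , wins) =
  record { guess = guessBlind ; local = guessBlind-local ; bounded = guessBlind-bounded off-u at-u }
  , λ c → let (x , correct) = wins c in x , guessBlind-correct c x correct
  where open RemoveEdge E h u v S'

corollary2p9 : (n : ℕ) (E : Digraph n) (h g : Fin n → ℕ) (u v : Fin n)
    → Loopless E → u ≢ v → E u v ≡ false → .{{_ : NonZero (h v)}}
    → Losing E h g
    → Losing (addEdge E u v) h (modifyGuesses h g u v)
corollary2p9 n E h g u v _ _ _ losing winning =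
  losing (Winning-removeEdge E h u v off-u at-u winning)
  where
  off-u : ∀ x → x ≢ u → modifyGuesses h g u v x ≤ g x
  off-u x x≢u = ≤-reflexive (modifyGuesses-≢ h g u v x≢u)

  at-u : h v * modifyGuesses h g u v u ≤ g u
  at-u = begin
    h v * modifyGuesses h g u v u ≡⟨ cong (h v *_) (modifyGuesses-≡ h g u v) ⟩
    h v * (g u / h v)             ≡⟨ *-comm (h v) (g u / h v) ⟩
    g u / h v * h v               ≤⟨ m/n*n≤m (g u) (h v) ⟩
    g u                           ∎
    where open ≤-Reasoning
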